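{- Let $t\geq 4$ be an integer and let $\Gamma$ be a finite group. Then $rc(CG(\Gamma))=t$ if and only if $\Gamma$ is nonabelian, has trivial center, and has exactly $t$ maximal abelian subgroups of order $2$.
   Context: For a finite group $\Gamma$, the commuting graph $CG(\Gamma)$ is the simple graph with vertex set $\Gamma$ in which two distinct elements $a,b$ are adjacent if and only if $ab=ba$. For a connected graph $G$, an edge coloring (adjacent edges may share colors) makes $G$ rainbow-connected if every two distinct vertices are joined by a path whose edges all have pairwise distinct colors; the rainbow connection number $rc(G)$ is the minimum number of colors in such a coloring. The center $Z(\Gamma)=\{z\in\Gamma: za=az \text{ for all } a\in\Gamma\}$ is trivial if it equals $\{e\}$. A maximal abelian subgroup of $\Gamma$ is an abelian subgroup not properly contained in any other abelian subgroup of $\Gamma$. -}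

module Defs where

open import Level using (0ℓ)
open import Data.Nat using (ℕ; _≤_)
open import Data.Fin using (Fin)
open import Data.Fin.Subset using (Subset; _∈_; _⊆_; ∣_∣)
open import Data.List using (List; []; _∷_; head; last; length)
open import Data.Maybe using (just)
open import Data.Product using (Σ; ∃; _×_; _,_)
open import Data.List.Relation.Unary.Linked using (Linked)
open import Data.List.Relation.Unary.Unique.Propositional using (Unique)
import Data.List.Membership.Propositional as LM
open import Relation.Binary.PropositionalEquality using (_≡_; _≢_)
open import Relation.Nullary using (¬_)
open import Algebra.Core using (Op₁; Op₂)
open import Algebra.Structures using (IsGroup)
open import Function.Bundles using (_⇔_)

-- Finite groups: a finite group of order n is presented on the carrier
-- Fin n with propositional equality (every finite group is isomorphic
-- to such a presentation).

record FiniteGroup : Set where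
  field
    order   : ℕ
    _∙_     : Op₂ (Fin order)
    ε       : Fin order
    _⁻¹     : Op₁ (Fin order)
    isGroup : IsGroup _≡_ _∙_ ε _⁻¹

record Graph : Set₁ where
  field
    size : ℕ
    Adj  : Fin size → Fin size → Set

module _ (G : Graph) where
  open Graph G

  -- an edge colouring with k colours (a colour for each unordered pair;
  -- only the values on edges matter)
  record EdgeColouring (k : ℕ) : Set where
    field
      colour    : Fin size → Fin size → Fin k
      symmetric : ∀ a b → colour a b ≡ colour b a

  edgeColours : ∀ {k} → (Fin size → Fin size → Fin k) → List (Fin size) → List (Fin k)
  edgeColours c []           = []
  edgeColours c (x ∷ [])     = []
  edgeColours c (x ∷ y ∷ xs) = c x y ∷ edgeColours c (y ∷ xs)

  record Path (u v : Fin size) : Set where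
    field
      vertices : List (Fin size)
      starts   : head vertices ≡ just u
      ends     : last vertices ≡ just v
      adjacent : Linked Adj vertices
      distinct : Unique vertices

  RainbowPath : ∀ {k} → EdgeColouring k → Fin size → Fin size → Set
  RainbowPath c u v =
    Σ (Path u v) λ p → Unique (edgeColours (EdgeColouring.colour c) (Path.vertices p))

  RainbowConnected : ∀ {k} → EdgeColouring k → Set
  RainbowConnected c = ∀ u v → u ≢ v → RainbowPath c u v

  RainbowColourable : ℕ → Set
  RainbowColourable k = Σ (EdgeColouring k) RainbowConnected

  RainbowConnectionNumber≡ : ℕ → Set
  RainbowConnectionNumber≡ t =
    RainbowColourable t × (∀ k → RainbowColourable k → t ≤ k)

module _ (Γ : FiniteGroup) where
  open FiniteGroup Γ

  CG : Graph
  CG = record { size = order ; Adj = λ a b → a ≢ b × (a ∙ b) ≡ (b ∙ a) }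

  NonAbelian : Set
  NonAbelian = ¬ (∀ a b → (a ∙ b) ≡ (b ∙ a))

  TrivialCenter : Set
  TrivialCenter = ∀ z → (∀ a → (z ∙ a) ≡ (a ∙ z)) → z ≡ ε

  record IsSubgroup (H : Subset order) : Set where
    field
      ε∈      : ε ∈ H
      ∙-closed : ∀ {a b} → a ∈ H → b ∈ H → (a ∙ b) ∈ H
      ⁻¹-closed : ∀ {a} → a ∈ H → (a ⁻¹) ∈ H

  IsAbelianSubgroup : Subset order → Set
  IsAbelianSubgroup H =
    IsSubgroup H × (∀ {a b} → a ∈ H → b ∈ H → (a ∙ b) ≡ (b ∙ a))

  IsMaximalAbelianSubgroup : Subset order → Set
  IsMaximalAbelianSubgroup H =
    IsAbelianSubgroup H × (∀ K → IsAbelianSubgroup K → H ⊆ K → K ≡ H)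

  HasExactlyMaxAbelianOfOrder2 : ℕ → Set
  HasExactlyMaxAbelianOfOrder2 t =
    Σ (List (Subset order)) λ Hs →
      Unique Hs × length Hs ≡ t ×
      (∀ H → (H LM.∈ Hs) ⇔ (IsMaximalAbelianSubgroup H × ∣ H ∣ ≡ 2))

{-# OPTIONS --safe #-}
module Submission where

-- In CG(Γ) the identity ε is adjacent to every other vertex, and q ≠ ε is a
-- pendant vertex (its only neighbour is ε) exactly when C(q) = {ε, q}, i.e.
-- exactly when {ε, q} is a maximal abelian subgroup of order 2.  A rainbow
-- path between two pendants must run through ε, so the p pendant edges need p
-- distinct colours and rc ≥ p.  Conversely max(3, p) colours suffice: each
-- pendant edge gets a private colour, and the other non-identity elements get
-- one of three labels such that each has a commuting neighbour with another
-- label (x and x⁻¹ for non-involutions; for an involution, whether it commutes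
-- with an element of order > 2, and otherwise, its centraliser then being an
-- elementary abelian 2-group, whether it is the least non-identity element
-- there).  An edge ε – x is coloured by the label of x and an edge x – y by the
-- label missing from both ends.  Hence for t ≥ 4, rc = t iff p = t, and two
-- pendants already force Γ to be nonabelian with trivial centre.

open import Algebra.Bundles using (Group)
import Algebra.Properties.Group as GroupProperties
open import Data.Empty using (⊥-elim)
open import Data.Fin as Fin using (Fin; zero; suc; _≟_)
open import Data.Fin.Induction using (<-wellFounded)
open import Data.Fin.Properties
  using (any?; all?; ¬∀⟶∃¬; injective⇒≤; inject≤-injective; <-asym; ≤-antisym)
open import Data.Fin.Subset using (Subset; _∈_; _⊆_; ∣_∣; ⁅_⁆; _∪_)
open import Data.Fin.Subset.Properties
  using ( _∈?_; x∈⁅x⁆; x∈⁅y⁆⇒x≡y; ∣⁅x⁆∣≡1; x∈p∪q⁺; x∈p∪q⁻; ⊆-antisym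
        ; p⊆q⇒∣p∣≤∣q∣; p⊂q⇒∣p∣<∣q∣; ∪-identityˡ; ∪-identityʳ)
open import Data.List using (List; []; _∷_; length; lookup; head; last; map; filter; allFin)
open import Data.List.Properties using (length-map)
open import Data.List.Membership.Propositional using () renaming (_∈_ to _∈ₗ_; _∉_ to _∉ₗ_)
import Data.List.Membership.DecPropositional as DecMembership
open import Data.List.Membership.Propositional.Properties
  using (∈-lookup; ∈-map⁺; ∈-map⁻; ∈-filter⁺; ∈-filter⁻; ∈-allFin)
open import Data.List.Membership.Propositional.Properties.WithK using (unique∧set⇒bag)
open import Data.List.Membership.Setoid.Properties using (index-injective)
open import Data.List.Relation.Binary.BagAndSetEquality using (∼bag⇒↭)
open import Data.List.Relation.Binary.Permutation.Propositional.Properties using (↭-length)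
open import Data.List.Relation.Unary.All as All using (All; []; _∷_)
open import Data.List.Relation.Unary.AllPairs using ([]; _∷_)
open import Data.List.Relation.Unary.Any using (here; there; index)
open import Data.List.Relation.Unary.Linked as Linked using (Linked; [-]; _∷_)
open import Data.List.Relation.Unary.Unique.Propositional using (Unique)
import Data.List.Relation.Unary.Unique.Propositional.Properties as Unique
open import Data.Maybe using (just)
open import Data.Nat as ℕ using (ℕ; _≤_; s≤s)
import Data.Nat.Properties as ℕ
open import Data.Product using (∃; _×_; _,_; proj₁; proj₂)
open import Data.Sum using (_⊎_; inj₁; inj₂)
open import Data.Vec using (tabulate)
open import Data.Vec.Properties using (lookup∘tabulate; lookup⇒[]=; []=⇒lookup)
open import Function using (_∘_)
open import Function.Bundles using (_⇔_; mk⇔; Equivalence)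
import Function.Properties.Equivalence as ⇔
open import Induction.WellFounded using (Acc; acc)
open import Level using (0ℓ)
open import Relation.Binary.PropositionalEquality
open import Relation.Nullary using (¬_; Dec; yes; no; does)
open import Relation.Nullary.Decidable using (_×-dec_; _→-dec_; ¬?; dec-true; from-yes)
open import Relation.Unary using (Pred; Decidable)

open import Defs

module _ {A : Set} where

  lookup-injective : ∀ {xs : List A} → Unique xs → ∀ i j → lookup xs i ≡ lookup xs j → i ≡ j
  lookup-injective (_ ∷ _)  zero    zero    _  = refl
  lookup-injective (x∉ ∷ _) zero    (suc j) eq = ⊥-elim (All.lookup x∉ (∈-lookup j) eq)
  lookup-injective (x∉ ∷ _) (suc i) zero    eq = ⊥-elim (All.lookup x∉ (∈-lookup i) (sym eq))
  lookup-injective (_ ∷ u)  (suc i) (suc j) eq = cong suc (lookup-injective u i j eq)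

  sameMembers⇒length≡ : ∀ {xs ys : List A} → Unique xs → Unique ys →
                        (∀ {x} → x ∈ₗ xs ⇔ x ∈ₗ ys) → length xs ≡ length ys
  sameMembers⇒length≡ u v same = ↭-length (∼bag⇒↭ (unique∧set⇒bag u v same))

  two-distinct : ∀ {xs : List A} → Unique xs → 2 ≤ length xs →
                 ∃ λ a → ∃ λ b → a ∈ₗ xs × b ∈ₗ xs × a ≢ b
  two-distinct {_ ∷ []}    _               (s≤s ())
  two-distinct {a ∷ b ∷ _} ((a≢b ∷ _) ∷ _) _ = a , b , here refl , there (here refl) , a≢b

  last-predecessor : ∀ {R : A → A → Set} {b} x y xs → Linked R (x ∷ y ∷ xs) →
                     last (x ∷ y ∷ xs) ≡ just b → ∃ λ z → z ∈ₗ x ∷ y ∷ xs × R z b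
  last-predecessor x y []       (r ∷ [-])    refl = x , here refl , r
  last-predecessor x y (w ∷ ws) (_ ∷ linked) eq   with last-predecessor y w ws linked eq
  ... | z , z∈ , r = z , there z∈ , r

module _ {n : ℕ} where

  least : ∀ {P : Pred (Fin n) 0ℓ} → Decidable P → ∀ {x} → P x →
          ∃ λ m → P m × (∀ {z} → P z → m Fin.≤ z)
  least {P} P? {x} px = go x px (<-wellFounded x)
    where
    go : ∀ x → P x → Acc Fin._<_ x → ∃ λ m → P m × (∀ {z} → P z → m Fin.≤ z)
    go x px (acc rec) with any? (λ z → P? z ×-dec z Fin.<? x)
    ... | yes (z , pz , z<x) = go z pz (rec z<x)
    ... | no ∄smaller        = x , px , λ pz → ℕ.≮⇒≥ (λ z<x → ∄smaller (_ , pz , z<x))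

  fromDec : ∀ {P : Pred (Fin n) 0ℓ} → Decidable P → Subset n
  fromDec P? = tabulate (does ∘ P?)

  module _ {P : Pred (Fin n) 0ℓ} (P? : Decidable P) where

    ∈-fromDec⁺ : ∀ {x} → P x → x ∈ fromDec P?
    ∈-fromDec⁺ {x} px = lookup⇒[]= x _ (trans (lookup∘tabulate _ x) (dec-true (P? x) px))

    ∈-fromDec⁻ : ∀ {x} → x ∈ fromDec P? → P x
    ∈-fromDec⁻ {x} x∈ with P? x | trans (sym (lookup∘tabulate (does ∘ P?) x)) ([]=⇒lookup x∈)
    ... | yes px | _ = px
    ... | no _   | ()

  ∈-⁅⁆∪⁅⁆⁺ : ∀ {x y z : Fin n} → z ≡ x ⊎ z ≡ y → z ∈ ⁅ x ⁆ ∪ ⁅ y ⁆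
  ∈-⁅⁆∪⁅⁆⁺ (inj₁ refl) = x∈p∪q⁺ (inj₁ (x∈⁅x⁆ _))
  ∈-⁅⁆∪⁅⁆⁺ (inj₂ refl) = x∈p∪q⁺ (inj₂ (x∈⁅x⁆ _))

  ∈-⁅⁆∪⁅⁆⁻ : ∀ {x y z : Fin n} → z ∈ ⁅ x ⁆ ∪ ⁅ y ⁆ → z ≡ x ⊎ z ≡ y
  ∈-⁅⁆∪⁅⁆⁻ {x} {y} z∈ with x∈p∪q⁻ ⁅ x ⁆ ⁅ y ⁆ z∈
  ... | inj₁ z∈x = inj₁ (x∈⁅y⁆⇒x≡y x z∈x)
  ... | inj₂ z∈y = inj₂ (x∈⁅y⁆⇒x≡y y z∈y)

  ⁅x⁆∪⁅-⁆-injective : ∀ {x y y′ : Fin n} → ⁅ x ⁆ ∪ ⁅ y ⁆ ≡ ⁅ x ⁆ ∪ ⁅ y′ ⁆ → y ≡ y′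
  ⁅x⁆∪⁅-⁆-injective {y = y} {y′} eq
    with ∈-⁅⁆∪⁅⁆⁻ (subst (y ∈_) eq (∈-⁅⁆∪⁅⁆⁺ (inj₂ refl)))
       | ∈-⁅⁆∪⁅⁆⁻ (subst (y′ ∈_) (sym eq) (∈-⁅⁆∪⁅⁆⁺ (inj₂ refl)))
  ... | inj₂ y≡y′ | _         = y≡y′
  ... | inj₁ _    | inj₂ y′≡y = sym y′≡y
  ... | inj₁ y≡x  | inj₁ y′≡x = trans y≡x (sym y′≡x)

∣⁅x⁆∪⁅y⁆∣≡2 : ∀ {n} {x y : Fin n} → x ≢ y → ∣ ⁅ x ⁆ ∪ ⁅ y ⁆ ∣ ≡ 2
∣⁅x⁆∪⁅y⁆∣≡2 {x = zero}  {zero}  x≢y = ⊥-elim (x≢y refl)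
∣⁅x⁆∪⁅y⁆∣≡2 {x = zero}  {suc y} _   = cong ℕ.suc (trans (cong ∣_∣ (∪-identityˡ ⁅ y ⁆)) (∣⁅x⁆∣≡1 y))
∣⁅x⁆∪⁅y⁆∣≡2 {x = suc x} {zero}  _   = cong ℕ.suc (trans (cong ∣_∣ (∪-identityʳ ⁅ x ⁆)) (∣⁅x⁆∣≡1 x))
∣⁅x⁆∪⁅y⁆∣≡2 {x = suc x} {suc y} x≢y = ∣⁅x⁆∪⁅y⁆∣≡2 (x≢y ∘ cong suc)

∣p∣≡2⇒p≡⁅x⁆∪⁅y⁆ : ∀ {n} {p : Subset n} {x} → ∣ p ∣ ≡ 2 → x ∈ p →
                   ∃ λ y → y ≢ x × p ≡ ⁅ x ⁆ ∪ ⁅ y ⁆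
∣p∣≡2⇒p≡⁅x⁆∪⁅y⁆ {p = p} {x} ∣p∣≡2 x∈p with any? (λ y → (y ∈? p) ×-dec ¬? (y ≟ x))
... | no ∄other =
  ⊥-elim (ℕ.<-irrefl refl (subst₂ _≤_ ∣p∣≡2 (∣⁅x⁆∣≡1 x) (p⊆q⇒∣p∣≤∣q∣ p⊆⁅x⁆)))
  where
  p⊆⁅x⁆ : p ⊆ ⁅ x ⁆
  p⊆⁅x⁆ {z} z∈p with z ≟ x
  ... | yes refl = x∈⁅x⁆ x
  ... | no z≢x   = ⊥-elim (∄other (z , z∈p , z≢x))
... | yes (y , y∈p , y≢x) = y , y≢x , ⊆-antisym p⊆pair pair⊆p
  where
  pair⊆p : ⁅ x ⁆ ∪ ⁅ y ⁆ ⊆ p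
  pair⊆p z∈ with ∈-⁅⁆∪⁅⁆⁻ z∈
  ... | inj₁ refl = x∈p
  ... | inj₂ refl = y∈p
  p⊆pair : p ⊆ ⁅ x ⁆ ∪ ⁅ y ⁆
  p⊆pair {z} z∈p with z ∈? ⁅ x ⁆ ∪ ⁅ y ⁆
  ... | yes z∈ = z∈
  ... | no z∉  = ⊥-elim (ℕ.<-irrefl (trans (∣⁅x⁆∪⁅y⁆∣≡2 (y≢x ∘ sym)) (sym ∣p∣≡2))
                                    (p⊂q⇒∣p∣<∣q∣ (pair⊆p , z , z∈p , z∉)))

bit : ∀ {A : Set} → Dec A → Fin 3
bit (yes _) = zero
bit (no _)  = suc zero

bit-<-flip : ∀ {n} {a b : Fin n} → a ≢ b → bit (a Fin.<? b) ≢ bit (b Fin.<? a)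
bit-<-flip {a = a} {b} a≢b with a Fin.<? b | b Fin.<? a
... | yes a<b | yes b<a = ⊥-elim (<-asym a<b b<a)
... | yes _   | no _    = λ ()
... | no _    | yes _   = λ ()
... | no a≮b  | no b≮a  = ⊥-elim (a≢b (≤-antisym (ℕ.≮⇒≥ b≮a) (ℕ.≮⇒≥ a≮b)))

third : Fin 3 → Fin 3 → Fin 3
third zero             (suc zero)       = suc (suc zero)
third (suc zero)       zero             = suc (suc zero)
third zero             (suc (suc zero)) = suc zero
third (suc (suc zero)) zero             = suc zero
third _                _                = zero

third-comm : ∀ a b → third a b ≡ third b a
third-comm = from-yes (all? λ a → all? λ b → third a b ≟ third b a)

third-fresh : ∀ a b → a ≢ b → third a b ≢ a × third a b ≢ b
third-fresh = from-yes (all? λ a → all? λ b →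
  ¬? (a ≟ b) →-dec (¬? (third a b ≟ a) ×-dec ¬? (third a b ≟ b)))

-- Rainbow colourings of a graph with a dominating vertex

module _ (G : Graph) where
  open Graph G

  IsPendantAt : Fin size → Fin size → Set
  IsPendantAt c q = q ≢ c × (∀ w → Adj q w → w ≡ c)

  HasDetours : Fin size → List (Fin size) → (Fin size → Fin 3) → Set
  HasDetours c qs label = ∀ {u} → u ≢ c → u ∉ₗ qs →
    ∃ λ u′ → Adj u u′ × u′ ≢ c × u′ ∉ₗ qs × label u′ ≢ label u

  module _ (adj-sym : ∀ {a b} → Adj a b → Adj b a) where

    -- Such a path is p – c – q: its second vertex is c, and so is the
    -- predecessor of q, but c cannot occur twice.
    rainbowPath⇒spokes≢ : ∀ {k} (col : EdgeColouring G k) {c p q} → let open EdgeColouring col in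
                          IsPendantAt c p → IsPendantAt c q → p ≢ q → ∀ vs →
                          head vs ≡ just p → last vs ≡ just q → Linked Adj vs → Unique vs →
                          Unique (edgeColours G colour vs) → colour p c ≢ colour q c
    rainbowPath⇒spokes≢ col _ _ p≢q (x ∷ []) refl refl _ _ _ = ⊥-elim (p≢q refl)
    rainbowPath⇒spokes≢ col (_ , p-adj) (q≢c , _) _ (x ∷ y ∷ []) refl refl (r ∷ _) _ _ =
      ⊥-elim (q≢c (p-adj y r))
    rainbowPath⇒spokes≢ col (_ , p-adj) _ _ (x ∷ y ∷ w ∷ []) refl refl (r ∷ _) _ ((c₁≢c₂ ∷ []) ∷ _)
      with refl ← p-adj y r = λ eq → c₁≢c₂ (trans eq (EdgeColouring.symmetric col w y))
    rainbowPath⇒spokes≢ col (_ , p-adj) (_ , q-adj) _ (x ∷ y ∷ w ∷ z ∷ vs) refl last≡ (r ∷ linked)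
                        (_ ∷ y∉ ∷ _) _
      with refl ← p-adj y r | z′ , z′∈ , z′q ← last-predecessor w z vs (Linked.tail linked) last≡ =
      ⊥-elim (All.lookup y∉ z′∈ (sym (q-adj z′ (adj-sym z′q))))

    pendants≤colours : ∀ {c k} qs → Unique qs → All (IsPendantAt c) qs →
                       RainbowColourable G k → length qs ≤ k
    pendants≤colours {c} qs unique pendant (col , connected) = injective⇒≤ spoke-injective
      where
      open EdgeColouring col
      spoke-injective : ∀ {i j} → colour (lookup qs i) c ≡ colour (lookup qs j) c → i ≡ j
      spoke-injective {i} {j} eq with lookup qs i ≟ lookup qs j
      ... | yes same = lookup-injective unique i j same
      ... | no differ with path , rainbow ← connected _ _ differ =
        ⊥-elim (rainbowPath⇒spokes≢ col (All.lookup pendant (∈-lookup i))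
                  (All.lookup pendant (∈-lookup j)) differ (Path.vertices path) (Path.starts path)
                  (Path.ends path) (Path.adjacent path) (Path.distinct path) rainbow eq)

  module _ (adj-irrefl : ∀ {a b} → Adj a b → a ≢ b) {k} (col : EdgeColouring G k) where
    open EdgeColouring col

    path₂ : ∀ {a b} → Adj a b → RainbowPath G col a b
    path₂ {a} {b} ab =
      record { vertices = a ∷ b ∷ [] ; starts = refl ; ends = refl
             ; adjacent = ab ∷ [-] ; distinct = (adj-irrefl ab ∷ []) ∷ [] ∷ [] }
      , [] ∷ []

    path₃ : ∀ {a b d} → Adj a b → Adj b d → a ≢ d → colour a b ≢ colour b d →
            RainbowPath G col a d
    path₃ {a} {b} {d} ab bd a≢d c₁≢c₂ =
      record { vertices = a ∷ b ∷ d ∷ [] ; starts = refl ; ends = refl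
             ; adjacent = ab ∷ bd ∷ [-]
             ; distinct = (adj-irrefl ab ∷ a≢d ∷ []) ∷ (adj-irrefl bd ∷ []) ∷ [] ∷ [] }
      , (c₁≢c₂ ∷ []) ∷ [] ∷ []

    path₄ : ∀ {a b d e} → Adj a b → Adj b d → Adj d e → a ≢ d → a ≢ e → b ≢ e →
            colour a b ≢ colour b d → colour a b ≢ colour d e → colour b d ≢ colour d e →
            RainbowPath G col a e
    path₄ {a} {b} {d} {e} ab bd de a≢d a≢e b≢e c₁≢c₂ c₁≢c₃ c₂≢c₃ =
      record { vertices = a ∷ b ∷ d ∷ e ∷ [] ; starts = refl ; ends = refl
             ; adjacent = ab ∷ bd ∷ de ∷ [-]
             ; distinct = (adj-irrefl ab ∷ a≢d ∷ a≢e ∷ []) ∷ (adj-irrefl bd ∷ b≢e ∷ [])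
                        ∷ (adj-irrefl de ∷ []) ∷ [] ∷ [] }
      , (c₁≢c₂ ∷ c₁≢c₃ ∷ []) ∷ (c₂≢c₃ ∷ []) ∷ [] ∷ []

  -- The edge c – v gets a private colour if v is listed in qs and the label of
  -- v otherwise; an edge between two vertices other than c gets the label
  -- missing from both ends, which makes a detour u – u′ – c rainbow.
  module _ (adj-sym : ∀ {a b} → Adj a b → Adj b a) (adj-irrefl : ∀ {a b} → Adj a b → a ≢ b)
           {c : Fin size} (c-adj : ∀ {v} → v ≢ c → Adj c v)
           {qs : List (Fin size)} {label : Fin size → Fin 3} (detour : HasDetours c qs label)
           {k : ℕ} (3≤k : 3 ≤ k) (qs≤k : length qs ≤ k) where

    private
      open DecMembership (_≟_ {size}) using () renaming (_∈?_ to _∈ₗ?_)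

      paint : Fin 3 → Fin k
      paint i = Fin.inject≤ i 3≤k

      spoke : Fin size → Fin k
      spoke v with v ∈ₗ? qs
      ... | yes v∈ = Fin.inject≤ (index v∈) qs≤k
      ... | no _   = paint (label v)

      colour : Fin size → Fin size → Fin k
      colour a b with a ≟ c | b ≟ c
      ... | yes _ | _     = spoke b
      ... | no _  | yes _ = spoke a
      ... | no _  | no _  = paint (third (label a) (label b))

      colour-comm : ∀ a b → colour a b ≡ colour b a
      colour-comm a b with a ≟ c | b ≟ c
      ... | yes refl | yes refl = refl
      ... | yes _    | no _     = refl
      ... | no _     | yes _    = refl
      ... | no _     | no _     = cong paint (third-comm (label a) (label b))

      col : EdgeColouring G k
      col = record { colour = colour ; symmetric = colour-comm }

      paint-injective : ∀ {i j} → paint i ≡ paint j → i ≡ j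
      paint-injective = inject≤-injective _ _ _ _

      painted-≢ : ∀ {x y i j} → x ≡ paint i → y ≡ paint j → i ≢ j → x ≢ y
      painted-≢ x≡ y≡ i≢j x≡y = i≢j (paint-injective (trans (sym x≡) (trans x≡y y≡)))

      spoke-∉ : ∀ {v} → v ∉ₗ qs → spoke v ≡ paint (label v)
      spoke-∉ {v} v∉ with v ∈ₗ? qs
      ... | yes v∈ = ⊥-elim (v∉ v∈)
      ... | no _   = refl

      spoke-injective : ∀ {u v} → u ∈ₗ qs → v ∈ₗ qs → spoke u ≡ spoke v → u ≡ v
      spoke-injective {u} {v} u∈ v∈ eq with u ∈ₗ? qs | v ∈ₗ? qs
      ... | no u∉   | _       = ⊥-elim (u∉ u∈)
      ... | yes _   | no v∉   = ⊥-elim (v∉ v∈)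
      ... | yes u∈′ | yes v∈′ =
        index-injective (setoid (Fin size)) u∈′ v∈′ (inject≤-injective _ _ _ _ eq)

      colour-from-c : ∀ {v} → v ≢ c → colour c v ≡ spoke v
      colour-from-c {v} v≢c with c ≟ c | v ≟ c
      ... | yes _  | _ = refl
      ... | no c≢c | _ = ⊥-elim (c≢c refl)

      colour-to-c : ∀ {u} → u ≢ c → colour u c ≡ spoke u
      colour-to-c u≢c = trans (colour-comm _ c) (colour-from-c u≢c)

      colour-rim : ∀ {a b} → a ≢ c → b ≢ c → colour a b ≡ paint (third (label a) (label b))
      colour-rim {a} {b} a≢c b≢c with a ≟ c | b ≟ c
      ... | yes a≡c | _       = ⊥-elim (a≢c a≡c)
      ... | no _    | yes b≡c = ⊥-elim (b≢c b≡c)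
      ... | no _    | no _    = refl

      adj-c : ∀ {u} → u ≢ c → Adj u c
      adj-c = adj-sym ∘ c-adj

      via-c : ∀ {u v} → u ≢ c → v ≢ c → u ≢ v → spoke u ≢ spoke v → RainbowPath G col u v
      via-c u≢c v≢c u≢v differ = path₃ adj-irrefl col (adj-c u≢c) (c-adj v≢c) u≢v
        (λ eq → differ (trans (sym (colour-to-c u≢c)) (trans eq (colour-from-c v≢c))))

      from-unlisted : ∀ {u v} → u ≢ c → u ∉ₗ qs → v ≢ c → u ≢ v → RainbowPath G col u v
      from-unlisted {u} {v} u≢c u∉ v≢c u≢v with paint (label u) ≟ spoke v
      ... | no differ = via-c u≢c v≢c u≢v (differ ∘ trans (sym (spoke-∉ u∉)))
      ... | yes same with u′ , uu′ , u′≢c , u′∉ , label≢ ← detour u≢c u∉ =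
        path₄ adj-irrefl col uu′ (adj-c u′≢c) (c-adj v≢c) u≢c u≢v u′≢v
          (painted-≢ e₁ e₂ (proj₂ fresh)) (painted-≢ e₁ e₃ (proj₁ fresh)) (painted-≢ e₂ e₃ label≢)
        where
        fresh = third-fresh (label u) (label u′) (label≢ ∘ sym)
        e₁ : colour u u′ ≡ paint (third (label u) (label u′))
        e₁ = colour-rim u≢c u′≢c
        e₂ : colour u′ c ≡ paint (label u′)
        e₂ = trans (colour-to-c u′≢c) (spoke-∉ u′∉)
        e₃ : colour c v ≡ paint (label u)
        e₃ = trans (colour-from-c v≢c) (sym same)
        u′≢v : u′ ≢ v
        u′≢v refl = label≢ (paint-injective (trans (sym (spoke-∉ u′∉)) (sym same)))

      to-unlisted : ∀ {u v} → u ≢ c → v ≢ c → v ∉ₗ qs → u ≢ v → RainbowPath G col u v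
      to-unlisted {u} {v} u≢c v≢c v∉ u≢v with spoke u ≟ paint (label v)
      ... | no differ = via-c u≢c v≢c u≢v (λ eq → differ (trans eq (spoke-∉ v∉)))
      ... | yes same with v′ , vv′ , v′≢c , v′∉ , label≢ ← detour v≢c v∉ =
        path₄ adj-irrefl col (adj-c u≢c) (c-adj v′≢c) (adj-sym vv′) u≢v′ u≢v (v≢c ∘ sym)
          (painted-≢ e₁ e₂ (label≢ ∘ sym)) (painted-≢ e₁ e₃ (proj₂ fresh ∘ sym))
          (painted-≢ e₂ e₃ (proj₁ fresh ∘ sym))
        where
        fresh = third-fresh (label v′) (label v) label≢
        e₁ : colour u c ≡ paint (label v)
        e₁ = trans (colour-to-c u≢c) same
        e₂ : colour c v′ ≡ paint (label v′)
        e₂ = trans (colour-from-c v′≢c) (spoke-∉ v′∉)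
        e₃ : colour v′ v ≡ paint (third (label v′) (label v))
        e₃ = colour-rim v′≢c v≢c
        u≢v′ : u ≢ v′
        u≢v′ refl = label≢ (paint-injective (trans (sym (spoke-∉ v′∉)) same))

      connected : RainbowConnected G col
      connected u v u≢v with u ≟ c | v ≟ c
      ... | yes refl | _        = path₂ adj-irrefl col (c-adj (u≢v ∘ sym))
      ... | no u≢c   | yes refl = path₂ adj-irrefl col (adj-c u≢c)
      ... | no u≢c   | no v≢c with u ∈ₗ? qs | v ∈ₗ? qs
      ...   | no u∉  | _      = from-unlisted u≢c u∉ v≢c u≢v
      ...   | yes _  | no v∉  = to-unlisted u≢c v≢c v∉ u≢v
      ...   | yes u∈ | yes v∈ = via-c u≢c v≢c u≢v (u≢v ∘ spoke-injective u∈ v∈)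

    detours⇒rainbowColourable : RainbowColourable G k
    detours⇒rainbowColourable = col , connected

-- 4 ≤ t makes t − 1 ≥ 3, so p < t would already give a colouring with t − 1 colours.
rainbowConnectionNumber≡⇔ : ∀ (G : Graph) {p t} →
                            (∀ {k} → RainbowColourable G k → p ≤ k) →
                            (∀ {k} → 3 ≤ k → p ≤ k → RainbowColourable G k) →
                            4 ≤ t → RainbowConnectionNumber≡ G t ⇔ p ≡ t
rainbowConnectionNumber≡⇔ G {p} {ℕ.suc t} lower upper (s≤s 3≤t) = mk⇔ to from
  where
  to : RainbowConnectionNumber≡ G (ℕ.suc t) → p ≡ ℕ.suc t
  to (colourable , minimal) = ℕ.≤-antisym (lower colourable) (ℕ.≮⇒≥ p≮1+t)
    where
    p≮1+t : ¬ p ℕ.< ℕ.suc t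
    p≮1+t (s≤s p≤t) = ℕ.<-irrefl refl (minimal t (upper 3≤t p≤t))
  from : p ≡ ℕ.suc t → RainbowConnectionNumber≡ G (ℕ.suc t)
  from refl = upper (ℕ.m≤n⇒m≤1+n 3≤t) ℕ.≤-refl , λ _ → lower

module _ (Γ : FiniteGroup) where
  open FiniteGroup Γ

  private
    group : Group 0ℓ 0ℓ
    group = record { isGroup = isGroup }
  open Group group using (assoc; identityˡ; identityʳ; inverseˡ; inverseʳ)
  open GroupProperties group using (ε⁻¹≈ε; ⁻¹-involutive; ⁻¹-injective; ⁻¹-anti-homo-∙)
  open ≡-Reasoning

  Commute : Fin order → Fin order → Set
  Commute a b = a ∙ b ≡ b ∙ a

  commute? : ∀ a b → Dec (Commute a b)
  commute? a b = (a ∙ b) ≟ (b ∙ a)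

  SelfInverse : Fin order → Set
  SelfInverse x = x ⁻¹ ≡ x

  ⁻¹-≢ε : ∀ {x} → x ≢ ε → x ⁻¹ ≢ ε
  ⁻¹-≢ε x≢ε x⁻¹≡ε = x≢ε (⁻¹-injective (trans x⁻¹≡ε (sym ε⁻¹≈ε)))

  ε-commute : ∀ a → Commute ε a
  ε-commute a = trans (identityˡ a) (sym (identityʳ a))

  commute-⁻¹ : ∀ a → Commute a (a ⁻¹)
  commute-⁻¹ a = trans (inverseʳ a) (sym (inverseˡ a))

  ∙-commute : ∀ {a b c} → Commute a c → Commute b c → Commute (a ∙ b) c
  ∙-commute {a} {b} {c} ac bc = begin
    (a ∙ b) ∙ c ≡⟨ assoc a b c ⟩
    a ∙ (b ∙ c) ≡⟨ cong (a ∙_) bc ⟩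
    a ∙ (c ∙ b) ≡⟨ assoc a c b ⟨
    (a ∙ c) ∙ b ≡⟨ cong (_∙ b) ac ⟩
    (c ∙ a) ∙ b ≡⟨ assoc c a b ⟩
    c ∙ (a ∙ b) ∎

  ⁻¹-commute : ∀ {a c} → Commute a c → Commute (a ⁻¹) c
  ⁻¹-commute {a} {c} ac = begin
    a′ ∙ c                ≡⟨ identityʳ _ ⟨
    (a′ ∙ c) ∙ ε          ≡⟨ cong ((a′ ∙ c) ∙_) (inverseʳ a) ⟨
    (a′ ∙ c) ∙ (a ∙ a′)   ≡⟨ assoc a′ c (a ∙ a′) ⟩
    a′ ∙ (c ∙ (a ∙ a′))   ≡⟨ cong (a′ ∙_) (assoc c a a′) ⟨
    a′ ∙ ((c ∙ a) ∙ a′)   ≡⟨ cong (λ x → a′ ∙ (x ∙ a′)) ac ⟨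
    a′ ∙ ((a ∙ c) ∙ a′)   ≡⟨ cong (a′ ∙_) (assoc a c a′) ⟩
    a′ ∙ (a ∙ (c ∙ a′))   ≡⟨ assoc a′ a (c ∙ a′) ⟨
    (a′ ∙ a) ∙ (c ∙ a′)   ≡⟨ cong (_∙ (c ∙ a′)) (inverseˡ a) ⟩
    ε ∙ (c ∙ a′)          ≡⟨ identityˡ _ ⟩
    c ∙ a′                ∎
    where a′ = a ⁻¹

  selfInverseCentraliser⇒commute : ∀ {m a b} → (∀ w → Commute m w → SelfInverse w) →
                                   Commute m a → Commute m b → Commute a b
  selfInverseCentraliser⇒commute {m} {a} {b} selfInverse ma mb = begin
    a ∙ b           ≡⟨ selfInverse (a ∙ b) (sym (∙-commute (sym ma) (sym mb))) ⟨
    (a ∙ b) ⁻¹      ≡⟨ ⁻¹-anti-homo-∙ a b ⟩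
    (b ⁻¹) ∙ (a ⁻¹) ≡⟨ cong₂ _∙_ (selfInverse b mb) (selfInverse a ma) ⟩
    b ∙ a           ∎

  -- K is the centre of C(a) ∩ C(b).
  commuting⇒inAbelianSubgroup : ∀ {a b} → Commute a b →
                                ∃ λ K → IsAbelianSubgroup Γ K × a ∈ K × b ∈ K
  commuting⇒inAbelianSubgroup {a} {b} ab = K , (subgroup , abelian) , ∈K⁺ a-central , ∈K⁺ b-central
    where
    Centralises : Fin order → Set
    Centralises g = Commute g a × Commute g b

    Central : Fin order → Set
    Central g = Centralises g × (∀ h → Centralises h → Commute g h)

    central? : Decidable Central
    central? g = (commute? g a ×-dec commute? g b) ×-dec
                 all? (λ h → (commute? h a ×-dec commute? h b) →-dec commute? g h)

    K = fromDec central?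
    ∈K⁺ = ∈-fromDec⁺ central?
    ∈K⁻ = ∈-fromDec⁻ central?

    a-central : Central a
    a-central = (refl , ab) , λ _ → sym ∘ proj₁

    b-central : Central b
    b-central = (sym ab , refl) , λ _ → sym ∘ proj₂

    ε-central : Central ε
    ε-central = (ε-commute a , ε-commute b) , λ h _ → ε-commute h

    ∙-central : ∀ {g h} → Central g → Central h → Central (g ∙ h)
    ∙-central ((ga , gb) , g-central) ((ha , hb) , h-central) =
      (∙-commute ga ha , ∙-commute gb hb) , λ x cx → ∙-commute (g-central x cx) (h-central x cx)

    ⁻¹-central : ∀ {g} → Central g → Central (g ⁻¹)
    ⁻¹-central ((ga , gb) , g-central) =
      (⁻¹-commute ga , ⁻¹-commute gb) , λ x cx → ⁻¹-commute (g-central x cx)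

    subgroup : IsSubgroup Γ K
    subgroup = record
      { ε∈       = ∈K⁺ ε-central
      ; ∙-closed  = λ g∈ h∈ → ∈K⁺ (∙-central (∈K⁻ g∈) (∈K⁻ h∈))
      ; ⁻¹-closed = ∈K⁺ ∘ ⁻¹-central ∘ ∈K⁻
      }

    abelian : ∀ {g h} → g ∈ K → h ∈ K → Commute g h
    abelian g∈ h∈ = proj₂ (∈K⁻ g∈) _ (proj₁ (∈K⁻ h∈))

  -- Pendant elements and maximal abelian subgroups of order 2

  Pendant : Fin order → Set
  Pendant = IsPendantAt (CG Γ) ε

  pendant? : Decidable Pendant
  pendant? q = ¬? (q ≟ ε) ×-dec all? (λ w → (¬? (q ≟ w) ×-dec commute? q w) →-dec (w ≟ ε))

  pendant-centraliser : ∀ {q y} → Pendant q → Commute q y → y ≡ ε ⊎ y ≡ q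
  pendant-centraliser {q} {y} (_ , only-ε) qy with y ≟ q
  ... | yes y≡q = inj₂ y≡q
  ... | no y≢q  = inj₁ (only-ε y (y≢q ∘ sym , qy))

  pendant-selfInverse : ∀ {q} → Pendant q → SelfInverse q
  pendant-selfInverse {q} pq@(q≢ε , _) with pendant-centraliser pq (commute-⁻¹ q)
  ... | inj₁ q⁻¹≡ε = ⊥-elim (⁻¹-≢ε q≢ε q⁻¹≡ε)
  ... | inj₂ q⁻¹≡q = q⁻¹≡q

  ⁅ε⁆∪⁅q⁆-abelianSubgroup : ∀ {q} → SelfInverse q → IsAbelianSubgroup Γ (⁅ ε ⁆ ∪ ⁅ q ⁆)
  ⁅ε⁆∪⁅q⁆-abelianSubgroup {q} q⁻¹≡q =
    record { ε∈ = ∈-⁅⁆∪⁅⁆⁺ (inj₁ refl) ; ∙-closed = ∙-closed ; ⁻¹-closed = ⁻¹-closed } , abelian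
    where
    H = ⁅ ε ⁆ ∪ ⁅ q ⁆
    ∙-closed : ∀ {a b} → a ∈ H → b ∈ H → (a ∙ b) ∈ H
    ∙-closed a∈ b∈ with ∈-⁅⁆∪⁅⁆⁻ a∈ | ∈-⁅⁆∪⁅⁆⁻ b∈
    ... | inj₁ refl | _         = subst (_∈ H) (sym (identityˡ _)) b∈
    ... | inj₂ refl | inj₁ refl = subst (_∈ H) (sym (identityʳ _)) a∈
    ... | inj₂ refl | inj₂ refl = ∈-⁅⁆∪⁅⁆⁺ (inj₁ (trans (cong (q ∙_) (sym q⁻¹≡q)) (inverseʳ q)))
    ⁻¹-closed : ∀ {a} → a ∈ H → (a ⁻¹) ∈ H
    ⁻¹-closed a∈ with ∈-⁅⁆∪⁅⁆⁻ a∈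
    ... | inj₁ refl = ∈-⁅⁆∪⁅⁆⁺ (inj₁ ε⁻¹≈ε)
    ... | inj₂ refl = ∈-⁅⁆∪⁅⁆⁺ (inj₂ q⁻¹≡q)
    abelian : ∀ {a b} → a ∈ H → b ∈ H → Commute a b
    abelian a∈ b∈ with ∈-⁅⁆∪⁅⁆⁻ a∈ | ∈-⁅⁆∪⁅⁆⁻ b∈
    ... | inj₁ refl | _         = ε-commute _
    ... | inj₂ refl | inj₁ refl = sym (ε-commute _)
    ... | inj₂ refl | inj₂ refl = refl

  MaximalAbelianOfOrder2 : Subset order → Set
  MaximalAbelianOfOrder2 H = IsMaximalAbelianSubgroup Γ H × ∣ H ∣ ≡ 2

  pendant⇒maximalAbelianOfOrder2 : ∀ {q} → Pendant q → MaximalAbelianOfOrder2 (⁅ ε ⁆ ∪ ⁅ q ⁆)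
  pendant⇒maximalAbelianOfOrder2 {q} pq@(q≢ε , _) =
    (⁅ε⁆∪⁅q⁆-abelianSubgroup (pendant-selfInverse pq) , maximal) , ∣⁅x⁆∪⁅y⁆∣≡2 (q≢ε ∘ sym)
    where
    maximal : ∀ K → IsAbelianSubgroup Γ K → ⁅ ε ⁆ ∪ ⁅ q ⁆ ⊆ K → K ≡ ⁅ ε ⁆ ∪ ⁅ q ⁆
    maximal K (_ , abelian) H⊆K = ⊆-antisym
      (λ x∈K → ∈-⁅⁆∪⁅⁆⁺ (pendant-centraliser pq (abelian (H⊆K (∈-⁅⁆∪⁅⁆⁺ (inj₂ refl))) x∈K)))
      H⊆K

  ⁅ε⁆∪⁅q⁆-maximal⇒centraliser⊆ : ∀ {q w} → IsMaximalAbelianSubgroup Γ (⁅ ε ⁆ ∪ ⁅ q ⁆) →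
                                   Commute q w → w ∈ ⁅ ε ⁆ ∪ ⁅ q ⁆
  ⁅ε⁆∪⁅q⁆-maximal⇒centraliser⊆ {q} {w} (_ , maximal) qw
    with K , K-abelian@(K-subgroup , _) , q∈K , w∈K ← commuting⇒inAbelianSubgroup qw =
    subst (w ∈_) (maximal K K-abelian H⊆K) w∈K
    where
    H⊆K : ⁅ ε ⁆ ∪ ⁅ q ⁆ ⊆ K
    H⊆K x∈ with ∈-⁅⁆∪⁅⁆⁻ x∈
    ... | inj₁ refl = IsSubgroup.ε∈ K-subgroup
    ... | inj₂ refl = q∈K

  maximalAbelianOfOrder2⇒pendant : ∀ {H} → MaximalAbelianOfOrder2 H →
                                   ∃ λ q → Pendant q × H ≡ ⁅ ε ⁆ ∪ ⁅ q ⁆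
  maximalAbelianOfOrder2⇒pendant (H-maximal@((subgroup , _) , _) , ∣H∣≡2)
    with q , q≢ε , refl ← ∣p∣≡2⇒p≡⁅x⁆∪⁅y⁆ ∣H∣≡2 (IsSubgroup.ε∈ subgroup) =
    q , (q≢ε , only-ε) , refl
    where
    only-ε : ∀ w → q ≢ w × Commute q w → w ≡ ε
    only-ε w (q≢w , qw) with ∈-⁅⁆∪⁅⁆⁻ (⁅ε⁆∪⁅q⁆-maximal⇒centraliser⊆ H-maximal qw)
    ... | inj₁ w≡ε = w≡ε
    ... | inj₂ w≡q = ⊥-elim (q≢w (sym w≡q))

  pendants : List (Fin order)
  pendants = filter pendant? (allFin order)

  pendants-unique : Unique pendants
  pendants-unique = Unique.filter⁺ pendant? (Unique.allFin⁺ order)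

  ∈-pendants⁺ : ∀ {q} → Pendant q → q ∈ₗ pendants
  ∈-pendants⁺ = ∈-filter⁺ pendant? (∈-allFin _)

  ∈-pendants⁻ : ∀ {q} → q ∈ₗ pendants → Pendant q
  ∈-pendants⁻ = proj₂ ∘ ∈-filter⁻ pendant? {xs = allFin order}

  maximalAbelianOfOrder2⇔pendantCount : ∀ t → HasExactlyMaxAbelianOfOrder2 Γ t ⇔ length pendants ≡ t
  maximalAbelianOfOrder2⇔pendantCount t = mk⇔ to from
    where
    pairs : List (Subset order)
    pairs = map (λ q → ⁅ ε ⁆ ∪ ⁅ q ⁆) pendants

    pairs-unique : Unique pairs
    pairs-unique = Unique.map⁺ ⁅x⁆∪⁅-⁆-injective pendants-unique

    ∈-pairs⇔ : ∀ H → H ∈ₗ pairs ⇔ MaximalAbelianOfOrder2 H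
    ∈-pairs⇔ H = mk⇔ pair⇒maximal maximal⇒pair
      where
      pair⇒maximal : H ∈ₗ pairs → MaximalAbelianOfOrder2 H
      pair⇒maximal H∈ with q , q∈ , refl ← ∈-map⁻ _ H∈ =
        pendant⇒maximalAbelianOfOrder2 (∈-pendants⁻ q∈)
      maximal⇒pair : MaximalAbelianOfOrder2 H → H ∈ₗ pairs
      maximal⇒pair H-max with q , pq , refl ← maximalAbelianOfOrder2⇒pendant H-max =
        ∈-map⁺ _ (∈-pendants⁺ pq)

    to : HasExactlyMaxAbelianOfOrder2 Γ t → length pendants ≡ t
    to (Hs , Hs-unique , length≡t , spec) = begin
      length pendants ≡⟨ length-map _ pendants ⟨
      length pairs    ≡⟨ sameMembers⇒length≡ pairs-unique Hs-unique
                           (λ {H} → ⇔.trans (∈-pairs⇔ H) (⇔.sym (spec H))) ⟩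
      length Hs       ≡⟨ length≡t ⟩
      t               ∎

    from : length pendants ≡ t → HasExactlyMaxAbelianOfOrder2 Γ t
    from length≡t = pairs , pairs-unique , trans (length-map _ pendants) length≡t , ∈-pairs⇔

  distinctPendants⇒nonAbelian×trivialCentre : ∀ {p q} → Pendant p → Pendant q → p ≢ q →
                                                NonAbelian Γ × TrivialCenter Γ
  distinctPendants⇒nonAbelian×trivialCentre {p} {q} pp@(_ , only-ε) pq@(q≢ε , _) p≢q =
    nonAbelian , trivialCentre
    where
    nonAbelian : NonAbelian Γ
    nonAbelian abelian = q≢ε (only-ε q (p≢q , abelian p q))
    trivialCentre : TrivialCenter Γ
    trivialCentre z central
      with pendant-centraliser pp (sym (central p)) | pendant-centraliser pq (sym (central q))
    ... | inj₁ z≡ε | _        = z≡ε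
    ... | inj₂ _   | inj₁ z≡ε = z≡ε
    ... | inj₂ z≡p | inj₂ z≡q = ⊥-elim (p≢q (trans (sym z≡p) z≡q))

  -- A labelling of the non-pendant elements

  CentralisesNonSelfInverse : Fin order → Set
  CentralisesNonSelfInverse x = ∃ λ w → Commute x w × ¬ SelfInverse w

  centralisesNonSelfInverse? : Decidable CentralisesNonSelfInverse
  centralisesNonSelfInverse? x = any? λ w → commute? x w ×-dec ¬? (w ⁻¹ ≟ w)

  LeastInCentraliser : Fin order → Set
  LeastInCentraliser x = ∀ y → y ≢ ε → Commute x y → x Fin.≤ y

  leastInCentraliser? : Decidable LeastInCentraliser
  leastInCentraliser? x = all? λ y → ¬? (y ≟ ε) →-dec (commute? x y →-dec (x Fin.≤? y))

  selfInverse-centraliser : ∀ {x} → ¬ CentralisesNonSelfInverse x →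
                            ∀ w → Commute x w → SelfInverse w
  selfInverse-centraliser {x} ¬c w xw with w ⁻¹ ≟ w
  ... | yes si = si
  ... | no ¬si = ⊥-elim (¬c (w , xw , ¬si))

  label : Fin order → Fin 3
  label x with x ⁻¹ ≟ x
  ... | no _ = bit (x Fin.<? x ⁻¹)
  ... | yes _ with centralisesNonSelfInverse? x
  ...   | yes _ = suc (suc zero)
  ...   | no _  = bit (leastInCentraliser? x)

  label-nonSelfInverse : ∀ {x} → ¬ SelfInverse x → label x ≡ bit (x Fin.<? x ⁻¹)
  label-nonSelfInverse {x} ¬si with x ⁻¹ ≟ x
  ... | yes si = ⊥-elim (¬si si)
  ... | no _   = refl

  label-centralising : ∀ {x} → SelfInverse x → CentralisesNonSelfInverse x →
                       label x ≡ suc (suc zero)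
  label-centralising {x} si c with x ⁻¹ ≟ x
  ... | no ¬si = ⊥-elim (¬si si)
  ... | yes _ with centralisesNonSelfInverse? x
  ...   | yes _ = refl
  ...   | no ¬c = ⊥-elim (¬c c)

  label-least : ∀ {x} → SelfInverse x → ¬ CentralisesNonSelfInverse x → LeastInCentraliser x →
                label x ≡ zero
  label-least {x} si ¬c least with x ⁻¹ ≟ x
  ... | no ¬si = ⊥-elim (¬si si)
  ... | yes _ with centralisesNonSelfInverse? x
  ...   | yes c = ⊥-elim (¬c c)
  ...   | no _ with leastInCentraliser? x
  ...     | yes _     = refl
  ...     | no ¬least = ⊥-elim (¬least least)

  label-notLeast : ∀ {x} → SelfInverse x → ¬ CentralisesNonSelfInverse x → ¬ LeastInCentraliser x →
                   label x ≡ suc zero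
  label-notLeast {x} si ¬c ¬least with x ⁻¹ ≟ x
  ... | no ¬si = ⊥-elim (¬si si)
  ... | yes _ with centralisesNonSelfInverse? x
  ...   | yes c = ⊥-elim (¬c c)
  ...   | no _ with leastInCentraliser? x
  ...     | yes least = ⊥-elim (¬least least)
  ...     | no _      = refl

  Partner : Fin order → Set
  Partner x = ∃ λ y → Commute x y × y ≢ ε × y ≢ x × label y ≢ label x

  partner-nonSelfInverse : ∀ {x} → x ≢ ε → ¬ SelfInverse x → Partner x
  partner-nonSelfInverse {x} x≢ε ¬si = x ⁻¹ , commute-⁻¹ x , ⁻¹-≢ε x≢ε , ¬si , labels≢
    where
    ¬si⁻¹ : ¬ SelfInverse (x ⁻¹)
    ¬si⁻¹ si⁻¹ = ¬si (trans (sym si⁻¹) (⁻¹-involutive x))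
    labels≢ : label (x ⁻¹) ≢ label x
    labels≢ rewrite label-nonSelfInverse ¬si | label-nonSelfInverse ¬si⁻¹ | ⁻¹-involutive x =
      bit-<-flip ¬si

  partner-centralising : ∀ {x} → SelfInverse x → CentralisesNonSelfInverse x → Partner x
  partner-centralising {x} si c@(w , xw , ¬siw) =
    w , xw , (λ { refl → ¬siw ε⁻¹≈ε }) , (λ { refl → ¬siw si }) , labels≢
    where
    labels≢ : label w ≢ label x
    labels≢ rewrite label-nonSelfInverse ¬siw | label-centralising si c with w Fin.<? w ⁻¹
    ... | yes _ = λ ()
    ... | no _  = λ ()

  nonPendant⇒neighbour : ∀ {x} → x ≢ ε → ¬ Pendant x → ∃ λ y → Commute x y × y ≢ ε × y ≢ x
  nonPendant⇒neighbour {x} x≢ε ¬px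
    with y , ¬only-ε ← ¬∀⟶∃¬ order _ (λ w → (¬? (x ≟ w) ×-dec commute? x w) →-dec (w ≟ ε))
                                   (λ only-ε → ¬px (x≢ε , only-ε))
    with x ≟ y | commute? x y
  ... | yes x≡y | _      = ⊥-elim (¬only-ε (λ (x≢y , _) → ⊥-elim (x≢y x≡y)))
  ... | no _    | no ¬xy = ⊥-elim (¬only-ε (λ (_ , xy) → ⊥-elim (¬xy xy)))
  ... | no x≢y  | yes xy = y , xy , (λ y≡ε → ¬only-ε (λ _ → y≡ε)) , x≢y ∘ sym

  partner-least : ∀ {x} → x ≢ ε → ¬ Pendant x → SelfInverse x → ¬ CentralisesNonSelfInverse x →
                  LeastInCentraliser x → Partner x
  partner-least {x} x≢ε ¬px si ¬c least with y , xy , y≢ε , y≢x ← nonPendant⇒neighbour x≢ε ¬px =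
    y , xy , y≢ε , y≢x , labels≢
    where
    siy : SelfInverse y
    siy = selfInverse-centraliser ¬c y xy
    labels≢ : label y ≢ label x
    labels≢ rewrite label-least si ¬c least with centralisesNonSelfInverse? y | leastInCentraliser? y
    ... | yes cy | _          rewrite label-centralising siy cy = λ ()
    ... | no _   | yes leasty = ⊥-elim (y≢x (≤-antisym (leasty x x≢ε (sym xy)) (least y y≢ε xy)))
    ... | no ¬cy | no ¬leasty rewrite label-notLeast siy ¬cy ¬leasty = λ ()

  partner-notLeast : ∀ {x} → x ≢ ε → SelfInverse x → ¬ CentralisesNonSelfInverse x →
                     ¬ LeastInCentraliser x → Partner x
  partner-notLeast {x} x≢ε si ¬c ¬least
    with m , (m≢ε , xm) , m≤ ← least (λ z → ¬? (z ≟ ε) ×-dec commute? x z) (x≢ε , refl) =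
    m , xm , m≢ε , m≢x , labels≢
    where
    m≢x : m ≢ x
    m≢x refl = ¬least λ y y≢ε my → m≤ (y≢ε , my)
    sim : SelfInverse m
    sim = selfInverse-centraliser ¬c m xm
    leastm : ¬ CentralisesNonSelfInverse m → LeastInCentraliser m
    leastm ¬cm y y≢ε my =
      m≤ (y≢ε , selfInverseCentraliser⇒commute (selfInverse-centraliser ¬cm) (sym xm) my)
    labels≢ : label m ≢ label x
    labels≢ rewrite label-notLeast si ¬c ¬least with centralisesNonSelfInverse? m
    ... | yes cm rewrite label-centralising sim cm = λ ()
    ... | no ¬cm rewrite label-least sim ¬cm (leastm ¬cm) = λ ()

  partner : ∀ {x} → x ≢ ε → ¬ Pendant x → Partner x
  partner {x} x≢ε ¬px = by-cases (x ⁻¹ ≟ x) (centralisesNonSelfInverse? x) (leastInCentraliser? x)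
    where
    by-cases : Dec (SelfInverse x) → Dec (CentralisesNonSelfInverse x) → Dec (LeastInCentraliser x) →
               Partner x
    by-cases (no ¬si) _       _           = partner-nonSelfInverse x≢ε ¬si
    by-cases (yes si) (yes c) _           = partner-centralising si c
    by-cases (yes si) (no ¬c) (yes least) = partner-least x≢ε ¬px si ¬c least
    by-cases (yes si) (no ¬c) (no ¬least) = partner-notLeast x≢ε si ¬c ¬least

  CG-adj-sym : ∀ {a b} → Graph.Adj (CG Γ) a b → Graph.Adj (CG Γ) b a
  CG-adj-sym (a≢b , ab) = a≢b ∘ sym , sym ab

  ε-adj : ∀ {v} → v ≢ ε → Graph.Adj (CG Γ) ε v
  ε-adj v≢ε = v≢ε ∘ sym , ε-commute _

  detours : HasDetours (CG Γ) ε pendants label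
  detours {u} u≢ε u∉ with y , uy , y≢ε , y≢u , label≢ ← partner u≢ε (u∉ ∘ ∈-pendants⁺) =
    y , (y≢u ∘ sym , uy) , y≢ε , y∉ , label≢
    where
    y∉ : y ∉ₗ pendants
    y∉ y∈ with pendant-centraliser (∈-pendants⁻ y∈) (sym uy)
    ... | inj₁ u≡ε = u≢ε u≡ε
    ... | inj₂ u≡y = y≢u (sym u≡y)

  CG-pendants≤colours : ∀ {k} → RainbowColourable (CG Γ) k → length pendants ≤ k
  CG-pendants≤colours =
    pendants≤colours (CG Γ) CG-adj-sym pendants pendants-unique (All.tabulate ∈-pendants⁻)

  CG-rainbowColourable : ∀ {k} → 3 ≤ k → length pendants ≤ k → RainbowColourable (CG Γ) k
  CG-rainbowColourable = detours⇒rainbowColourable (CG Γ) CG-adj-sym proj₁ ε-adj detours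

theorem7 : (t : ℕ) → 4 ≤ t → (Γ : FiniteGroup) →
    RainbowConnectionNumber≡ (CG Γ) t
      ⇔ (NonAbelian Γ × TrivialCenter Γ × HasExactlyMaxAbelianOfOrder2 Γ t)
theorem7 t 4≤t Γ = mk⇔ to from
  where
  rc≡t⇔ : RainbowConnectionNumber≡ (CG Γ) t ⇔ length (pendants Γ) ≡ t
  rc≡t⇔ = rainbowConnectionNumber≡⇔ (CG Γ) (CG-pendants≤colours Γ) (CG-rainbowColourable Γ) 4≤t

  count≡t⇔ : HasExactlyMaxAbelianOfOrder2 Γ t ⇔ length (pendants Γ) ≡ t
  count≡t⇔ = maximalAbelianOfOrder2⇔pendantCount Γ t

  to : RainbowConnectionNumber≡ (CG Γ) t →
       NonAbelian Γ × TrivialCenter Γ × HasExactlyMaxAbelianOfOrder2 Γ t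
  to rc≡t with count≡t ← Equivalence.to rc≡t⇔ rc≡t
    with p , q , p∈ , q∈ , p≢q ← two-distinct (pendants-unique Γ)
                                   (ℕ.≤-trans (ℕ.m≤n+m 2 2) (subst (4 ≤_) (sym count≡t) 4≤t))
    with nonAbelian , trivialCentre ← distinctPendants⇒nonAbelian×trivialCentre Γ
                                        (∈-pendants⁻ Γ p∈) (∈-pendants⁻ Γ q∈) p≢q
    = nonAbelian , trivialCentre , Equivalence.from count≡t⇔ count≡t

  from : NonAbelian Γ × TrivialCenter Γ × HasExactlyMaxAbelianOfOrder2 Γ t →
         RainbowConnectionNumber≡ (CG Γ) t
  from (_ , _ , exactly) = Equivalence.from rc≡t⇔ (Equivalence.to count≡t⇔ exactly)
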